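{- For each $n<\omega$, the quasi-equation $$\Big(s_0\subseteq s_n\ \wedge\ \bigwedge_{i<n} s_i\subseteq s_{i+1}*t\Big)\ \to\ s_0*t\subseteq s_n*t$$ is valid over $R(\subseteq,*)$; that is, for every non-empty set $X$ and all $s_0,\dots,s_n,t\in\mathrm{Rel}(X)$, if $s_0\subseteq s_n$ and $s_i\subseteq s_{i+1}*t$ for all $i<n$, then $s_0*t\subseteq s_n*t$.
   Context: $\mathrm{Rel}(X)$ is the set of binary relations on $X$. Demonic composition: $s*t=\{(x,y):\exists z((x,z)\in s\wedge(z,y)\in t)\wedge\forall w((x,w)\in s\to\exists v\,(w,v)\in t)\}$. $R(\subseteq,*)$ is the class of structures isomorphic to sets of binary relations closed under $*$ and ordered by inclusion. -}

module Defs where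

open import Data.Product using (Σ; ∃; _×_)

Rel : Set → Set₁
Rel X = X → X → Set

_⊆ᵣ_ : {X : Set} → Rel X → Rel X → Set
_⊆ᵣ_ {X} s t = (x y : X) → s x y → t x y

_*ᵈ_ : {X : Set} → Rel X → Rel X → Rel X
_*ᵈ_ {X} s t x y =
  (Σ X λ z → s x z × t z y) × ((w : X) → s x w → Σ X λ v → t w v)

-- A point x lies in the domain of s *ᵈ t exactly when it is safe: it has an
-- s-successor and all its s-successors have t-successors. Each hypothesis
-- s_i ⊆ s_{i+1} *ᵈ t carries safety of x from s_i to s_{i+1}, so a point in the
-- domain of s_0 *ᵈ t is safe for s_n, and s_0 ⊆ s_n supplies the witness.

module Submission where

open import Defs
open import Data.Nat using (ℕ; suc)
open import Data.Fin using (Fin; zero; fromℕ; inject₁)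
open import Data.Product using (Σ; _×_; _,_)

Safe : {X : Set} → Rel X → Rel X → X → Set
Safe {X} s t x = (Σ X λ z → s x z) × ((w : X) → s x w → Σ X λ v → t w v)

safe-⊆*ᵈ : {X : Set} {s r t : Rel X} {x : X} →
  s ⊆ᵣ (r *ᵈ t) → Safe s t x → Safe r t x
safe-⊆*ᵈ {x = x} s⊆r*t ((z , sxz) , _) with s⊆r*t x z sxz
... | (w , rxw , _) , total = (w , rxw) , total

safe-chain : (n : ℕ) {X : Set} (s : Fin (suc n) → Rel X) (t : Rel X) {x : X} →
  ((i : Fin n) → s (inject₁ i) ⊆ᵣ (s (Data.Fin.suc i) *ᵈ t)) →
  Safe (s zero) t x → Safe (s (fromℕ n)) t x
safe-chain ℕ.zero    s t chain safe = safe
safe-chain (suc n) s t chain safe =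
  safe-⊆*ᵈ (chain (fromℕ n))
    (safe-chain n (λ i → s (inject₁ i)) t (λ i → chain (inject₁ i)) safe)

mainTheorem12 : (n : ℕ) (X : Set) → X → (s : Fin (suc n) → Rel X) (t : Rel X) →
    s zero ⊆ᵣ s (fromℕ n) →
    ((i : Fin n) → s (inject₁ i) ⊆ᵣ (s (Data.Fin.suc i) *ᵈ t)) →
    (s zero *ᵈ t) ⊆ᵣ (s (fromℕ n) *ᵈ t)
mainTheorem12 n X _ s t s₀⊆sₙ chain x y ((z , sxz , tzy) , total)
  with safe-chain n s t chain ((z , sxz) , total)
... | _ , totalₙ = (z , s₀⊆sₙ x z sxz , tzy) , totalₙ
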